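{- Let $n \geq 0$ and $0 \leq k \leq n$ be integers. The poset $\Omega_{n,k}$ has the Boolean algebra decomposition $$\Omega_{n,k} = \bigcup_{v \in \Omega''_{n,k}} [v, \psi(v)],$$ that is, $\Omega_{n,k}$ is the union of the intervals $[v,\psi(v)]$ for $v \in \Omega''_{n,k}$, these intervals are pairwise disjoint, and each is isomorphic to a Boolean algebra.
   Context: $\Omega_{n,k}$ is the set of all words $w = w_1 w_2 \cdots w_n$ of length $n$ over $\{0,1\}$ with exactly $n-k$ zeroes and $k$ ones. It is made into a graded poset by declaring the cover relations to be $u \circ 01 \circ v \prec u \circ 10 \circ v$ for words $u,v$, where $\circ$ denotes concatenation, and taking the partial order generated by them. Intervals $[x,y]=\{z : x\le z\le y\}$ are taken in this poset. $\Omega''_{n,k}$ is the set of words $v \in \Omega_{n,k}$ with $v_1 \leq v_2$, $v_3 \leq v_4$, $\ldots$, $v_{2\lfloor n/2\rfloor -1} \leq v_{2\lfloor n/2 \rfloor}$ (no condition on $v_n$ when $n$ is odd). For $w \in \Omega_{n,k}$, $\psi(w)$ is the word $\max(w_1,w_2),\min(w_1,w_2),\max(w_3,w_4),\min(w_3,w_4),\ldots$, i.e. each pair of positions $(2i-1,2i)$ is sorted in decreasing order, and when $n$ is odd the last entry $w_n$ stays in place. -}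

module Defs where

open import Data.Bool using (Bool; true; false; _∧_; _∨_; if_then_else_) renaming (_≤_ to _≤ᵇ_)
open import Data.Nat using (ℕ; zero; suc)
open import Data.List using (List; []; _∷_; _++_; length; map)
open import Data.Nat.ListAction using (sum)
open import Data.Fin.Subset using (Subset; _⊆_)
open import Data.Product using (Σ; _×_; proj₁)
open import Data.Unit using (⊤)
open import Relation.Binary.PropositionalEquality using (_≡_)
open import Relation.Binary.Construct.Closure.ReflexiveTransitive using (Star)
open import Function.Bundles using (_⇔_)

-- Words over {0,1}: 0 = false, 1 = true.
Word : Set
Word = List Bool

ones : Word → ℕ
ones w = sum (map (λ b → if b then 1 else 0) w)

Ω : ℕ → ℕ → Word → Set
Ω n k w = (length w ≡ n) × (ones w ≡ k)

data _⋖_ : Word → Word → Set where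
  cover : (u v : Word) → (u ++ false ∷ true ∷ v) ⋖ (u ++ true ∷ false ∷ v)

_≼_ : Word → Word → Set
_≼_ = Star _⋖_

PairSorted : Word → Set
PairSorted []            = ⊤
PairSorted (_ ∷ [])      = ⊤
PairSorted (a ∷ b ∷ r)   = (a ≤ᵇ b) × PairSorted r

Ω″ : ℕ → ℕ → Word → Set
Ω″ n k v = Ω n k v × PairSorted v

ψ : Word → Word
ψ []          = []
ψ (a ∷ [])    = a ∷ []
ψ (a ∷ b ∷ r) = (a ∨ b) ∷ (a ∧ b) ∷ ψ r

Interval : ℕ → ℕ → Word → Word → Set
Interval n k x y = Σ Word λ z → Ω n k z × (x ≼ z) × (z ≼ y)

record IsoToBoolean (n k : ℕ) (x y : Word) : Set where
  field
    m       : ℕ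
    to      : Interval n k x y → Subset m
    from    : Subset m → Interval n k x y
    from∘to : ∀ z → proj₁ (from (to z)) ≡ proj₁ z
    to∘from : ∀ s → to (from s) ≡ s
    order   : ∀ z₁ z₂ → (proj₁ z₁ ≼ proj₁ z₂) ⇔ (to z₁ ⊆ to z₂)

module Submission where

-- Every cover 01 ↦ 10 preserves length and number of ones, and can
-- only increase the prefix counts of ones; so x ≼ y implies the dominance
-- order x ⊑ y (prefix counts of x bounded by those of y).  For any word v,
-- read as pairs of letters, the words lying above v and below ψ v in
-- dominance order (and of the same length) are exactly the words
-- 'fill v s': every pair 01 of v is replaced by 01 or 10 according to a bit
-- of s, all other pairs are kept.  Filling is an order embedding from
-- subsets to ≼, which gives the Boolean interval [v, ψ v].  Finally,
-- sorting every pair increasingly recovers v from any fill of a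
-- pair-sorted v, and every word is a fill of its own pair-sorting; this
-- gives that the intervals cover Ω_{n,k} and are pairwise disjoint.

open import Defs
open import Data.Nat using (ℕ; suc; _+_; _≤_; z≤n; s≤s)
open import Data.Nat.Properties
  using (≤-refl; ≤-trans; +-monoʳ-≤; +-assoc; +-cancelˡ-≤; suc-injective; module ≤-Reasoning)
open import Data.Nat.ListAction using (sum)
open import Data.Nat.ListAction.Properties using (sum-++)
open import Data.List using (List; []; _∷_; _++_; length; map; take; drop)
open import Data.List.Properties using (length-++; map-++)
open import Data.Bool using (Bool; true; false; not; _∧_; _∨_; if_then_else_; b≤b; f≤t)
open import Data.Vec using ([]; _∷_; here)
open import Data.Fin.Subset using (Subset; _⊆_)
open import Data.Fin.Subset.Properties using (⊆-refl; drop-∷-⊆; out⊆; s⊆s)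
open import Data.Product using (Σ; _×_; _,_; proj₁)
open import Data.Unit using (tt)
open import Function using (_∘_)
open import Function.Bundles using (_⇔_; mk⇔)
open import Relation.Binary.PropositionalEquality using (_≡_; refl; sym; trans; cong; subst₂)
open import Relation.Binary.Construct.Closure.ReflexiveTransitive using (ε; _◅_; _◅◅_; gmap)

bit : Bool → ℕ
bit b = if b then 1 else 0

ones-++ : ∀ u w → ones (u ++ w) ≡ ones u + ones w
ones-++ u w = trans (cong sum (map-++ bit u w)) (sum-++ (map bit u) (map bit w))

SameCounts : Word → Word → Set
SameCounts x y = (length x ≡ length y) × (ones x ≡ ones y)

⋖-sameCounts : ∀ {x y} → x ⋖ y → SameCounts x y
⋖-sameCounts (cover u v) =
  trans (length-++ u) (sym (length-++ u)) , trans (ones-++ u _) (sym (ones-++ u _))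

≼-sameCounts : ∀ {x y} → x ≼ y → SameCounts x y
≼-sameCounts ε = refl , refl
≼-sameCounts (c ◅ cs) with ⋖-sameCounts c | ≼-sameCounts cs
... | l , o | l′ , o′ = trans l l′ , trans o o′

Ω-upward : ∀ {n k x y} → x ≼ y → Ω n k x → Ω n k y
Ω-upward x≼y (l , o) with ≼-sameCounts x≼y
... | l′ , o′ = trans (sym l′) l , trans (sym o′) o

Ω-downward : ∀ {n k x y} → x ≼ y → Ω n k y → Ω n k x
Ω-downward x≼y (l , o) with ≼-sameCounts x≼y
... | l′ , o′ = trans l′ l , trans o′ o

≼-cons : ∀ a {x y} → x ≼ y → (a ∷ x) ≼ (a ∷ y)
≼-cons a = gmap (a ∷_) (λ { (cover u v) → cover (a ∷ u) v })

≼-pair : ∀ a b {x y} → x ≼ y → (a ∷ b ∷ x) ≼ (a ∷ b ∷ y)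
≼-pair a b = ≼-cons a ∘ ≼-cons b

swap01 : ∀ y → (false ∷ true ∷ y) ≼ (true ∷ false ∷ y)
swap01 y = cover [] y ◅ ε

-- Dominance order: every prefix of u has at most as many ones as the
-- prefix of w of the same length.  (A record, so that u and w can be
-- inferred from a proof.)
prefixOnes : Word → ℕ → ℕ
prefixOnes w j = ones (take j w)

record _⊑_ (u w : Word) : Set where
  constructor dominated
  field at : ∀ j → prefixOnes u j ≤ prefixOnes w j
open _⊑_

-- Moving a one to the left raises prefix counts, so ≼ refines ⊑.
⋖⇒⊑ : ∀ {x y} → x ⋖ y → x ⊑ y
⋖⇒⊑ (cover u v) = dominated (raise u)
  where
  raise : ∀ u j → prefixOnes (u ++ false ∷ true ∷ v) j ≤ prefixOnes (u ++ true ∷ false ∷ v) j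
  raise []      0             = z≤n
  raise []      1             = z≤n
  raise []      (suc (suc j)) = ≤-refl
  raise (a ∷ u) 0             = z≤n
  raise (a ∷ u) (suc j)       = +-monoʳ-≤ (bit a) (raise u j)

≼⇒⊑ : ∀ {x y} → x ≼ y → x ⊑ y
≼⇒⊑ ε = dominated (λ _ → ≤-refl)
≼⇒⊑ (c ◅ cs) = dominated (λ j → ≤-trans (at (⋖⇒⊑ c) j) (at (≼⇒⊑ cs) j))

peel : ∀ {a b c d x y} → bit a + bit b ≡ bit c + bit d →
       (a ∷ b ∷ x) ⊑ (c ∷ d ∷ y) → x ⊑ y
peel {a} {b} {c} {d} {x} {y} same x⊑y = dominated λ j →
  +-cancelˡ-≤ (bit a + bit b) _ _ (begin
    bit a + bit b + prefixOnes x j   ≡⟨ +-assoc (bit a) (bit b) _ ⟩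
    bit a + (bit b + prefixOnes x j) ≤⟨ at x⊑y (suc (suc j)) ⟩
    bit c + (bit d + prefixOnes y j) ≡⟨ sym (+-assoc (bit c) (bit d) _) ⟩
    bit c + bit d + prefixOnes y j   ≡⟨ cong (_+ prefixOnes y j) (sym same) ⟩
    bit a + bit b + prefixOnes y j   ∎)
  where open ≤-Reasoning

free : Word → ℕ
free []                  = 0
free (_ ∷ [])            = 0
free (false ∷ false ∷ r) = free r
free (false ∷ true ∷ r)  = suc (free r)
free (true ∷ _ ∷ r)      = free r

fill : (v : Word) → Subset (free v) → Word
fill []                  _       = []
fill (a ∷ [])            _       = a ∷ []
fill (false ∷ false ∷ r) s       = false ∷ false ∷ fill r s
fill (false ∷ true ∷ r)  (c ∷ s) = c ∷ not c ∷ fill r s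
fill (true ∷ b ∷ r)      s       = true ∷ b ∷ fill r s

firstLetter : Word → Bool
firstLetter []      = false
firstLetter (c ∷ _) = c

choice : (v z : Word) → Subset (free v)
choice []                  _ = []
choice (_ ∷ [])            _ = []
choice (false ∷ false ∷ r) z = choice r (drop 2 z)
choice (false ∷ true ∷ r)  z = firstLetter z ∷ choice r (drop 2 z)
choice (true ∷ _ ∷ r)      z = choice r (drop 2 z)

choice-fill : ∀ v s → choice v (fill v s) ≡ s
choice-fill []                  []      = refl
choice-fill (_ ∷ [])            []      = refl
choice-fill (false ∷ false ∷ r) s       = choice-fill r s
choice-fill (false ∷ true ∷ r)  (c ∷ s) = cong (c ∷_) (choice-fill r s)
choice-fill (true ∷ _ ∷ r)      s       = choice-fill r s

fill-above : ∀ v s → v ≼ fill v s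
fill-above []                  _           = ε
fill-above (_ ∷ [])            _           = ε
fill-above (false ∷ false ∷ r) s           = ≼-pair false false (fill-above r s)
fill-above (false ∷ true ∷ r)  (false ∷ s) = ≼-pair false true (fill-above r s)
fill-above (false ∷ true ∷ r)  (true ∷ s)  = swap01 r ◅◅ ≼-pair true false (fill-above r s)
fill-above (true ∷ b ∷ r)      s           = ≼-pair true b (fill-above r s)

fill-below : ∀ v s → fill v s ≼ ψ v
fill-below []                  _           = ε
fill-below (_ ∷ [])            _           = ε
fill-below (false ∷ false ∷ r) s           = ≼-pair false false (fill-below r s)
fill-below (false ∷ true ∷ r)  (false ∷ s) = swap01 _ ◅◅ ≼-pair true false (fill-below r s)
fill-below (false ∷ true ∷ r)  (true ∷ s)  = ≼-pair true false (fill-below r s)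
fill-below (true ∷ b ∷ r)      s           = ≼-pair true b (fill-below r s)

drop-pair : ∀ (x y : Word) → suc (suc (length x)) ≡ suc (suc (length y)) → length x ≡ length y
drop-pair _ _ = suc-injective ∘ suc-injective

-- Conversely every word of the right length between v and ψ v in
-- dominance order is a fill of v: the prefix counts at the end of each
-- pair force that pair.
⊑-between⇒fill : ∀ v z → length z ≡ length v → v ⊑ z → z ⊑ ψ v → z ≡ fill v (choice v z)
⊑-between⇒fill []                  []                  _  _  _  = refl
⊑-between⇒fill []                  (_ ∷ _)             () _  _
⊑-between⇒fill (_ ∷ [])            []                  () _  _
⊑-between⇒fill (_ ∷ [])            (_ ∷ _ ∷ _)         () _  _
⊑-between⇒fill (false ∷ [])        (false ∷ [])        _  _  _  = refl
⊑-between⇒fill (false ∷ [])        (true ∷ [])         _  _  hi with at hi 1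
... | ()
⊑-between⇒fill (true ∷ [])         (false ∷ [])        _  lo _  with at lo 1
... | ()
⊑-between⇒fill (true ∷ [])         (true ∷ [])         _  _  _  = refl
⊑-between⇒fill (_ ∷ _ ∷ _)         []                  () _  _
⊑-between⇒fill (_ ∷ _ ∷ _)         (_ ∷ [])            () _  _
⊑-between⇒fill (false ∷ false ∷ r) (false ∷ false ∷ z) l  lo hi =
  cong (λ t → false ∷ false ∷ t) (⊑-between⇒fill r z (drop-pair z r l) (peel refl lo) (peel refl hi))
⊑-between⇒fill (false ∷ false ∷ r) (false ∷ true ∷ z)  _  _  hi with at hi 2
... | ()
⊑-between⇒fill (false ∷ false ∷ r) (true ∷ _ ∷ z)      _  _  hi with at hi 1
... | ()
⊑-between⇒fill (false ∷ true ∷ r)  (false ∷ false ∷ z) _  lo _  with at lo 2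
... | ()
⊑-between⇒fill (false ∷ true ∷ r)  (false ∷ true ∷ z)  l  lo hi =
  cong (λ t → false ∷ true ∷ t) (⊑-between⇒fill r z (drop-pair z r l) (peel refl lo) (peel refl hi))
⊑-between⇒fill (false ∷ true ∷ r)  (true ∷ false ∷ z)  l  lo hi =
  cong (λ t → true ∷ false ∷ t) (⊑-between⇒fill r z (drop-pair z r l) (peel refl lo) (peel refl hi))
⊑-between⇒fill (false ∷ true ∷ r)  (true ∷ true ∷ z)   _  _  hi with at hi 2
... | s≤s ()
⊑-between⇒fill (true ∷ false ∷ r)  (false ∷ _ ∷ z)     _  lo _  with at lo 1
... | ()
⊑-between⇒fill (true ∷ false ∷ r)  (true ∷ false ∷ z)  l  lo hi =
  cong (λ t → true ∷ false ∷ t) (⊑-between⇒fill r z (drop-pair z r l) (peel refl lo) (peel refl hi))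
⊑-between⇒fill (true ∷ false ∷ r)  (true ∷ true ∷ z)   _  _  hi with at hi 2
... | s≤s ()
⊑-between⇒fill (true ∷ true ∷ r)   (false ∷ _ ∷ z)     _  lo _  with at lo 1
... | ()
⊑-between⇒fill (true ∷ true ∷ r)   (true ∷ false ∷ z)  _  lo _  with at lo 2
... | s≤s ()
⊑-between⇒fill (true ∷ true ∷ r)   (true ∷ true ∷ z)   l  lo hi =
  cong (λ t → true ∷ true ∷ t) (⊑-between⇒fill r z (drop-pair z r l) (peel refl lo) (peel refl hi))

fill-mono : ∀ v (s t : Subset (free v)) → s ⊆ t → fill v s ≼ fill v t
fill-mono []                  _           _           _   = ε
fill-mono (_ ∷ [])            _           _           _   = ε
fill-mono (false ∷ false ∷ r) s           t           s⊆t = ≼-pair false false (fill-mono r s t s⊆t)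
fill-mono (false ∷ true ∷ r)  (false ∷ s) (false ∷ t) s⊆t =
  ≼-pair false true (fill-mono r s t (drop-∷-⊆ s⊆t))
fill-mono (false ∷ true ∷ r)  (false ∷ s) (true ∷ t)  s⊆t =
  ≼-pair false true (fill-mono r s t (drop-∷-⊆ s⊆t)) ◅◅ swap01 _
fill-mono (false ∷ true ∷ r)  (true ∷ s)  (false ∷ t) s⊆t with s⊆t here
... | ()
fill-mono (false ∷ true ∷ r)  (true ∷ s)  (true ∷ t)  s⊆t =
  ≼-pair true false (fill-mono r s t (drop-∷-⊆ s⊆t))
fill-mono (true ∷ b ∷ r)      s           t           s⊆t = ≼-pair true b (fill-mono r s t s⊆t)

fill-reflects : ∀ v (s t : Subset (free v)) → fill v s ⊑ fill v t → s ⊆ t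
fill-reflects []                  []          []          _  = ⊆-refl
fill-reflects (_ ∷ [])            []          []          _  = ⊆-refl
fill-reflects (false ∷ false ∷ r) s           t           st = fill-reflects r s t (peel refl st)
fill-reflects (false ∷ true ∷ r)  (false ∷ s) (false ∷ t) st = out⊆ (fill-reflects r s t (peel refl st))
fill-reflects (false ∷ true ∷ r)  (false ∷ s) (true ∷ t)  st = out⊆ (fill-reflects r s t (peel refl st))
fill-reflects (false ∷ true ∷ r)  (true ∷ s)  (false ∷ t) st with at st 1
... | ()
fill-reflects (false ∷ true ∷ r)  (true ∷ s)  (true ∷ t)  st = s⊆s (fill-reflects r s t (peel refl st))
fill-reflects (true ∷ b ∷ r)      s           t           st = fill-reflects r s t (peel refl st)

fill-order : ∀ v (s t : Subset (free v)) → (fill v s ≼ fill v t) ⇔ (s ⊆ t)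
fill-order v s t = mk⇔ (fill-reflects v s t ∘ ≼⇒⊑) (fill-mono v s t)

interval⇒fill : ∀ {n k} v z → Ω n k v → Ω n k z → v ≼ z → z ≼ ψ v → z ≡ fill v (choice v z)
interval⇒fill v z (lv , _) (lz , _) v≼z z≼ψv =
  ⊑-between⇒fill v z (trans lz (sym lv)) (≼⇒⊑ v≼z) (≼⇒⊑ z≼ψv)

interval-boolean : ∀ {n k} v → Ω n k v → IsoToBoolean n k v (ψ v)
interval-boolean v Ωv = record
  { m       = free v
  ; to      = λ z → choice v (proj₁ z)
  ; from    = λ s → fill v s , Ω-upward (fill-above v s) Ωv , fill-above v s , fill-below v s
  ; from∘to = λ { (z , Ωz , v≼z , z≼ψv) → sym (interval⇒fill v z Ωv Ωz v≼z z≼ψv) }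
  ; to∘from = choice-fill v
  ; order   = λ { (z₁ , Ωz₁ , v≼z₁ , z₁≼ψv) (z₂ , Ωz₂ , v≼z₂ , z₂≼ψv) →
      subst₂ (λ x y → (x ≼ y) ⇔ (choice v z₁ ⊆ choice v z₂))
        (sym (interval⇒fill v z₁ Ωv Ωz₁ v≼z₁ z₁≼ψv))
        (sym (interval⇒fill v z₂ Ωv Ωz₂ v≼z₂ z₂≼ψv))
        (fill-order v (choice v z₁) (choice v z₂)) }
  }

sortPairs : Word → Word
sortPairs []          = []
sortPairs (a ∷ [])    = a ∷ []
sortPairs (a ∷ b ∷ r) = (a ∧ b) ∷ (a ∨ b) ∷ sortPairs r

sortPairs-sorted : ∀ w → PairSorted (sortPairs w)
sortPairs-sorted []                  = tt
sortPairs-sorted (_ ∷ [])            = tt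
sortPairs-sorted (false ∷ false ∷ r) = b≤b , sortPairs-sorted r
sortPairs-sorted (false ∷ true ∷ r)  = f≤t , sortPairs-sorted r
sortPairs-sorted (true ∷ false ∷ r)  = f≤t , sortPairs-sorted r
sortPairs-sorted (true ∷ true ∷ r)   = b≤b , sortPairs-sorted r

fill-sortPairs : ∀ w → w ≡ fill (sortPairs w) (choice (sortPairs w) w)
fill-sortPairs []                  = refl
fill-sortPairs (_ ∷ [])            = refl
fill-sortPairs (false ∷ false ∷ r) = cong (λ t → false ∷ false ∷ t) (fill-sortPairs r)
fill-sortPairs (false ∷ true ∷ r)  = cong (λ t → false ∷ true ∷ t) (fill-sortPairs r)
fill-sortPairs (true ∷ false ∷ r)  = cong (λ t → true ∷ false ∷ t) (fill-sortPairs r)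
fill-sortPairs (true ∷ true ∷ r)   = cong (λ t → true ∷ true ∷ t) (fill-sortPairs r)

sortPairs-fill : ∀ v s → PairSorted v → sortPairs (fill v s) ≡ v
sortPairs-fill []                  _           _        = refl
sortPairs-fill (_ ∷ [])            _           _        = refl
sortPairs-fill (false ∷ false ∷ r) s           (_ , ps) = cong (λ t → false ∷ false ∷ t) (sortPairs-fill r s ps)
sortPairs-fill (false ∷ true ∷ r)  (false ∷ s) (_ , ps) = cong (λ t → false ∷ true ∷ t) (sortPairs-fill r s ps)
sortPairs-fill (false ∷ true ∷ r)  (true ∷ s)  (_ , ps) = cong (λ t → false ∷ true ∷ t) (sortPairs-fill r s ps)
sortPairs-fill (true ∷ false ∷ r)  _           (() , _)
sortPairs-fill (true ∷ true ∷ r)   s           (_ , ps) = cong (λ t → true ∷ true ∷ t) (sortPairs-fill r s ps)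

interval-base : ∀ {n k} v w → Ω″ n k v → Ω n k w → v ≼ w → w ≼ ψ v → sortPairs w ≡ v
interval-base v w (Ωv , ps) Ωw v≼w w≼ψv =
  trans (cong sortPairs (interval⇒fill v w Ωv Ωw v≼w w≼ψv)) (sortPairs-fill v _ ps)

sortPairs≼ : ∀ w → sortPairs w ≼ w
sortPairs≼ w = subst₂ _≼_ refl (sym (fill-sortPairs w)) (fill-above (sortPairs w) _)

≼ψ-sortPairs : ∀ w → w ≼ ψ (sortPairs w)
≼ψ-sortPairs w = subst₂ _≼_ (sym (fill-sortPairs w)) refl (fill-below (sortPairs w) _)

theorem2p2 : (n k : ℕ) → k ≤ n →
    ((w : List Bool) → Ω n k w → Σ (List Bool) λ v → Ω″ n k v × (v ≼ w) × (w ≼ ψ v))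
    × ((v : List Bool) → Ω″ n k v → (w : List Bool) → v ≼ w → w ≼ ψ v → Ω n k w)
    × ((v v′ w : List Bool) → Ω″ n k v → Ω″ n k v′ → Ω n k w →
    v ≼ w → w ≼ ψ v → v′ ≼ w → w ≼ ψ v′ → v ≡ v′)
    × ((v : List Bool) → Ω″ n k v → IsoToBoolean n k v (ψ v))
theorem2p2 n k _ = covering , closed , disjoint , boolean
  where
  covering : ∀ w → Ω n k w → Σ Word λ v → Ω″ n k v × (v ≼ w) × (w ≼ ψ v)
  covering w Ωw =
    sortPairs w , (Ω-downward (sortPairs≼ w) Ωw , sortPairs-sorted w) , sortPairs≼ w , ≼ψ-sortPairs w

  closed : ∀ v → Ω″ n k v → ∀ w → v ≼ w → w ≼ ψ v → Ω n k w
  closed v (Ωv , _) w v≼w _ = Ω-upward v≼w Ωv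

  disjoint : ∀ v v′ w → Ω″ n k v → Ω″ n k v′ → Ω n k w →
             v ≼ w → w ≼ ψ v → v′ ≼ w → w ≼ ψ v′ → v ≡ v′
  disjoint v v′ w Ω″v Ω″v′ Ωw v≼w w≼ψv v′≼w w≼ψv′ =
    trans (sym (interval-base v w Ω″v Ωw v≼w w≼ψv)) (interval-base v′ w Ω″v′ Ωw v′≼w w≼ψv′)

  boolean : ∀ v → Ω″ n k v → IsoToBoolean n k v (ψ v)
  boolean v (Ωv , _) = interval-boolean v Ωv
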